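{- Fix integers $l\ge2$ and $j,k\ge1$ with $j\le k$. Let $Z(M,N)$ be the weighted number of paths from $(0,0)$ to $(M,N)$ in the model with a left wall at $x=0$ and filters of type 1 at $x=nl-1$ for all integers $n\ge j$, with elementary steps only, and let $Z'(M,N)$ be the weighted number of paths from $(0,0)$ to $(M,N)$ in the same model augmented by the long steps $\mathbb{S}(k)$ (see context). Then for every lattice point $(M,N)$ with $lk-1\le M\le l(k+2)-2$: (i) if $N\le M+2l-2$, then $Z'(M,N)=Z(M,N)$; (ii) if $M+2l\le N\le l(k+4)-2$, then $Z'(M,N)=Z(M,N)+Z(M+2l,N)$.
   Context: Lattice: $\mathcal{L}=\{(x,y)\in\mathbb{Z}^2: x+y\equiv 0 \pmod 2\}$. A lattice path model is given by a set of allowed steps $(x,y)\to(x',y+1)$, each with a positive weight. A path from $(0,0)$ to $(M,N)$ is a sequence $P_0=(0,0),\dots,P_N=(M,N)$ of lattice points with each $P_i\to P_{i+1}$ allowed; its weight is the product of step weights; the weighted number of paths is the sum of weights of all such paths ($0$ if none). Left wall at $x=0$: from $(0,y)$ the only step is $(0,y)\to(1,y+1)$, weight $1$. Filter of type 1 at $x=d$: from $(d,y)$ the only step is $(d,y)\to(d+1,y+1)$, weight $1$; from $(d+1,y)$ the only steps are $(d+1,y)\to(d+2,y+1)$ with weight $1$ and $(d+1,y)\to(d,y+1)$ with weight $2$. From every other point $(x,y)$ the steps are $(x,y)\to(x\pm1,y+1)$, weight $1$. Long steps $\mathbb{S}(k)$: $(l(k+2)-2,\,lk-2+2m)\to(lk-1,\,lk-1+2m)$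 for all integers $m\ge0$, each of weight $1$, added to the steps already allowed. -}

module Defs where

open import Data.Bool using (Bool; true; false; if_then_else_; _∧_; _∨_)
open import Data.Nat as ℕ using (ℕ; zero; suc; _≡ᵇ_; _≤ᵇ_)
open import Data.Nat.DivMod using (_%_)
open import Data.Integer as ℤ using (ℤ; +_; -[1+_]; ∣_∣)
open import Data.List using (List; []; _∷_; upTo; map; _++_)
open import Data.Bool.ListAction using (any)
open import Data.Nat.ListAction using (sum)
open import Data.Product using (_×_; _,_)
open import Relation.Nullary.Decidable using (⌊_⌋)

-- A lattice path model (steps go from (x,y) to (x',y+1)) is given by the
-- list of its allowed steps out of each point (x,y): pairs (x', weight).
Model : Set
Model = ℤ → ℤ → List (ℤ × ℕ)

-- x = i*l - 1 for some integer i ≥ j   (x a natural number here;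
-- since l ≥ 1, such i satisfies i ≤ x+1, so the bounded search is exhaustive)
isFilterℕ : (l j : ℕ) → ℕ → Bool
isFilterℕ l j x = any (λ i → (j ≤ᵇ i) ∧ (i ℕ.* l ≡ᵇ suc x)) (upTo (suc (suc x)))

isFilter : (l j : ℕ) → ℤ → Bool
isFilter l j (+ x)    = isFilterℕ l j x
isFilter l j -[1+ _ ] = false

isAfterFilter : (l j : ℕ) → ℤ → Bool
isAfterFilter l j x = isFilter l j (x ℤ.- ℤ.1ℤ)

elementary : (l j : ℕ) → Model
elementary l j x y =
  if ⌊ x ℤ.≟ ℤ.0ℤ ⌋ then (ℤ.1ℤ , 1) ∷ []
  else if isFilter l j x then (x ℤ.+ ℤ.1ℤ , 1) ∷ []
  else if isAfterFilter l j x then (x ℤ.+ ℤ.1ℤ , 1) ∷ (x ℤ.- ℤ.1ℤ , 2) ∷ []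
  else (x ℤ.+ ℤ.1ℤ , 1) ∷ (x ℤ.- ℤ.1ℤ , 1) ∷ []

-- Long steps S(k): (l(k+2)-2, lk-2+2m) → (lk-1, lk-1+2m), m ≥ 0, weight 1.
longSteps : (l k : ℕ) → Model
longSteps l k x y =
  if ⌊ x ℤ.≟ (+ (l ℕ.* (k ℕ.+ 2)) ℤ.- + 2) ⌋
     ∧ ⌊ (+ (l ℕ.* k) ℤ.- + 2) ℤ.≤? y ⌋
     ∧ (∣ y ℤ.- (+ (l ℕ.* k) ℤ.- + 2) ∣ % 2 ≡ᵇ 0)
  then (+ (l ℕ.* k) ℤ.- ℤ.1ℤ , 1) ∷ []
  else []

withLong : (l j k : ℕ) → Model
withLong l j k x y = elementary l j x y ++ longSteps l k x y

countFrom : Model → ℕ → ℤ → ℤ → ℤ → ℕ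
countFrom S zero    x y M = if ⌊ x ℤ.≟ M ⌋ then 1 else 0
countFrom S (suc n) x y M =
  sum (map (λ { (x' , w) → w ℕ.* countFrom S n x' (y ℤ.+ ℤ.1ℤ) M }) (S x y))

-- Weighted number of paths from (0,0) to (M,N): such paths have exactly N
-- steps; 0 if N < 0.
paths : Model → ℤ → ℤ → ℕ
paths S M (+ n)    = countFrom S n ℤ.0ℤ ℤ.0ℤ M
paths S M -[1+ _ ] = 0

Z : (l j : ℕ) → ℤ → ℤ → ℕ
Z l j = paths (elementary l j)

Z′ : (l j k : ℕ) → ℤ → ℤ → ℕ
Z′ l j k = paths (withLong l j k)

module Submission where

-- Write c = lk − 2 and a = c + 2l = l(k+2) − 2, so that the long steps jump from a to the filter
-- c + 1 = lk − 1, and a + 1 is again a filter.  From lk − 1 on the filters are 2l-periodic, so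
-- elementary path counts there are invariant under the shift x ↦ x + 2l.  Replacing the long step
-- a → c + 1 by the elementary step a → a + 1 = (c + 1) + 2l and shifting the rest of the path by 2l
-- turns the paths using one long step into the elementary paths ending at M + 2l; these cross a + 1
-- once and for all, since a + 1 is a filter and nothing beyond it returns to M ≤ a.  For
-- N ≤ l(k+4) − 2 there is no room for a second long step, which gives Z′ = Z + Z(· + 2l, ·); for
-- N ≤ M + 2l − 2 there is no room even for one, and Z′ = Z.

open import Defs
open import Data.Bool using (Bool; true; false; if_then_else_; T; _∧_)
open import Data.Bool.Properties using (T-≡; T-∧; ⇔→≡)
open import Data.Nat as ℕ using (ℕ; zero; suc; pred; _+_; _*_; _≤_; _<_; _≤ᵇ_; _≡ᵇ_; s≤s; z≤n; s≤s⁻¹)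
open import Data.Nat.Properties
open import Algebra.Properties.CommutativeSemigroup +-commutativeSemigroup
  using () renaming (interchange to +-interchange)
open import Data.Nat.Divisibility using (_∣_; divides; m∣m*n; ∣m+n∣m⇒∣n; ∣m∣n⇒∣m+n; ∣1⇒≡1)
open import Data.Nat.DivMod using (_%_; m*n%n≡0)
open import Data.Nat.ListAction using (sum)
open import Data.Nat.Tactic.RingSolver using (solve-∀)
open import Data.Integer as ℤ using (ℤ; +_; -[1+_])
import Data.Integer.Properties as ℤ
open import Data.List using (List; []; _∷_; map; _++_; upTo)
open import Data.List.Properties using (++-identityʳ)
open import Data.List.Relation.Unary.All using (All; []; _∷_)
import Data.List.Relation.Unary.All as All
open import Data.List.Relation.Unary.Any using (satisfied)
open import Data.List.Relation.Unary.Any.Properties using (any⁺; any⁻)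
open import Data.List.Membership.Propositional using (_∈_; lose)
open import Data.List.Membership.Propositional.Properties using (∈-upTo⁺)
open import Data.Product using (_×_; _,_; ∃-syntax; proj₁; proj₂; map₁)
open import Data.Sum using (inj₁; inj₂)
open import Data.Empty using (⊥-elim)
open import Function using (_∘_; _⇔_; mk⇔; Equivalence; case_of_)
open import Relation.Nullary using (Dec; yes; no; ¬_)
open import Relation.Nullary.Decidable using (⌊_⌋; isYes≗does; dec-true)
open import Relation.Binary.PropositionalEquality

stepSum : (ℤ → ℕ) → List (ℤ × ℕ) → ℕ
stepSum f []             = 0
stepSum f ((x , w) ∷ ss) = w * f x + stepSum f ss

sum-map≡stepSum : ∀ (F : ℤ × ℕ → ℕ) f → (∀ x w → F (x , w) ≡ w * f x) →
                  ∀ ss → sum (map F ss) ≡ stepSum f ss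
sum-map≡stepSum F f F≡ []             = refl
sum-map≡stepSum F f F≡ ((x , w) ∷ ss) = cong₂ _+_ (F≡ x w) (sum-map≡stepSum F f F≡ ss)

countRest : Model → ℕ → ℤ → ℤ → ℤ → ℕ
countRest S n y M x′ = countFrom S n x′ (y ℤ.+ ℤ.1ℤ) M

countFrom-suc : ∀ S n x y M → countFrom S (suc n) x y M ≡ stepSum (countRest S n y M) (S x y)
countFrom-suc S n x y M = sum-map≡stepSum _ _ (λ _ _ → refl) (S x y)

countFrom-zero-≢ : ∀ S {x} y {M} → x ≢ M → countFrom S 0 x y M ≡ 0
countFrom-zero-≢ S {x} y {M} x≢M with x ℤ.≟ M
... | yes x≡M = ⊥-elim (x≢M x≡M)
... | no _    = refl

countFrom-zero-cong : ∀ S S′ {x x′} y y′ {M M′} → (x ≡ M ⇔ x′ ≡ M′) →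
                      countFrom S 0 x y M ≡ countFrom S′ 0 x′ y′ M′
countFrom-zero-cong S S′ {x} {x′} y y′ {M} {M′} x≡M⇔x′≡M′ with x ℤ.≟ M | x′ ℤ.≟ M′
... | yes _   | yes _    = refl
... | no _    | no _     = refl
... | yes x≡M | no x′≢M′ = ⊥-elim (x′≢M′ (Equivalence.to x≡M⇔x′≡M′ x≡M))
... | no x≢M  | yes x′≡M′ = ⊥-elim (x≢M (Equivalence.from x≡M⇔x′≡M′ x′≡M′))

stepSum-++ : ∀ f ss ts → stepSum f (ss ++ ts) ≡ stepSum f ss + stepSum f ts
stepSum-++ f []             ts = refl
stepSum-++ f ((x , w) ∷ ss) ts =
  trans (cong (_+_ (w * f x)) (stepSum-++ f ss ts)) (sym (+-assoc (w * f x) _ _))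

stepSum-+ : ∀ f g ss → stepSum (λ x → f x + g x) ss ≡ stepSum f ss + stepSum g ss
stepSum-+ f g []             = refl
stepSum-+ f g ((x , w) ∷ ss) =
  trans (cong₂ _+_ (*-distribˡ-+ w (f x) (g x)) (stepSum-+ f g ss))
        (+-interchange (w * f x) (w * g x) (stepSum f ss) (stepSum g ss))

stepSum-cong : ∀ {f g ss} → All (λ s → f (proj₁ s) ≡ g (proj₁ s)) ss → stepSum f ss ≡ stepSum g ss
stepSum-cong []                       = refl
stepSum-cong {ss = (_ , w) ∷ _} (e ∷ es) = cong₂ _+_ (cong (w *_) e) (stepSum-cong es)

stepSum-zero : ∀ {f ss} → All (λ s → f (proj₁ s) ≡ 0) ss → stepSum f ss ≡ 0
stepSum-zero []                       = refl
stepSum-zero {ss = (_ , w) ∷ _} (e ∷ es) =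
  cong₂ _+_ (trans (cong (w *_) e) (*-zeroʳ w)) (stepSum-zero es)

stepSum-map₁ : ∀ f g ss → stepSum f (map (map₁ g) ss) ≡ stepSum (f ∘ g) ss
stepSum-map₁ f g []             = refl
stepSum-map₁ f g ((x , w) ∷ ss) = cong (_+_ (w * f (g x))) (stepSum-map₁ f g ss)

<-right-step : ∀ {n p B} → suc n + p < B → n + suc p < B
<-right-step {n} {p} {B} = subst (_< B) (sym (+-suc n p))

<-left-step : ∀ {n p B} → suc n + suc p < B → n + p < B
<-left-step {n} {p} = ≤-<-trans (+-mono-≤ (n≤1+n n) (n≤1+n p))

≤-minus-2 : ∀ {n} x → + n ℤ.≤ + x ℤ.- + 2 → 2 + n ≤ x
≤-minus-2 (suc (suc x)) (ℤ.+≤+ n≤x) = s≤s (s≤s n≤x)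

∣+[m+n]-+m∣≡n : ∀ m n → ℤ.∣ + (m + n) ℤ.- + m ∣ ≡ n
∣+[m+n]-+m∣≡n m n = begin
  ℤ.∣ + (m + n) ℤ.- + m ∣ ≡⟨ cong ℤ.∣_∣ (ℤ.m-n≡m⊖n (m + n) m) ⟩
  ℤ.∣ (m + n) ℤ.⊖ m ∣     ≡⟨ cong ℤ.∣_∣ (ℤ.≤-⊖ (m≤m+n m n)) ⟩
  (m + n) ℕ.∸ m           ≡⟨ m+n∸m≡n m n ⟩
  n                       ∎
  where open ≡-Reasoning

+m≤?+[m+n] : ∀ m n → ⌊ + m ℤ.≤? + (m + n) ⌋ ≡ true
+m≤?+[m+n] m n = trans (isYes≗does m≤?m+n) (dec-true m≤?m+n (ℤ.+≤+ (m≤m+n m n)))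
  where
  m≤?m+n : Dec (+ m ℤ.≤ + (m + n))
  m≤?m+n = + m ℤ.≤? + (m + n)

2*t%2≡0 : ∀ t → 2 * t % 2 ≡ 0
2*t%2≡0 t = trans (cong (_% 2) (*-comm 2 t)) (m*n%n≡0 t 2)

isFilterWitness : (l j x i : ℕ) → Bool
isFilterWitness l j x i = (j ≤ᵇ i) ∧ (i * l ≡ᵇ suc x)

isFilterℕ-sound : ∀ l j {x} → isFilterℕ l j x ≡ true → ∃[ i ] j ≤ i × i * l ≡ suc x
isFilterℕ-sound l j {x} filter =
  let i , witness = satisfied (any⁻ (isFilterWitness l j x) (upTo (suc (suc x)))
                                   (Equivalence.from T-≡ filter))
      j≤ᵇi , il≡ᵇ  = Equivalence.to (T-∧ {j ≤ᵇ i}) witness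
  in  i , ≤ᵇ⇒≤ j i j≤ᵇi , ≡ᵇ⇒≡ (i * l) (suc x) il≡ᵇ

isFilterℕ-complete : ∀ l j {x} i .{{_ : ℕ.NonZero l}} → j ≤ i → i * l ≡ suc x →
                     isFilterℕ l j x ≡ true
isFilterℕ-complete l j {x} i j≤i il≡ =
  Equivalence.to T-≡ (any⁺ (isFilterWitness l j x) (lose i∈ witness))
  where
  i∈ : i ∈ upTo (suc (suc x))
  i∈ = ∈-upTo⁺ (s≤s (≤-trans (m≤m*n i l) (≤-reflexive il≡)))
  witness : T (isFilterWitness l j x i)
  witness = Equivalence.from T-∧ (≤⇒≤ᵇ j≤i , ≡⇒≡ᵇ (i * l) (suc x) il≡)

Corollary4p2-conclusion : (l j k : ℕ) → ℤ → ℤ → Set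
Corollary4p2-conclusion l j k M N =
  (N ℤ.≤ M ℤ.+ + (2 ℕ.* l) ℤ.- + 2 → Z′ l j k M N ≡ Z l j M N)
  × (M ℤ.+ + (2 ℕ.* l) ℤ.≤ N → N ℤ.≤ + (l ℕ.* (k ℕ.+ 4)) ℤ.- + 2 →
     Z′ l j k M N ≡ Z l j M N ℕ.+ Z l j (M ℤ.+ + (2 ℕ.* l)) N)

module LongStepModel (l j k c : ℕ) (l≥2 : 2 ≤ l) (j≤k : j ≤ k) (lk≡2+c : l * k ≡ 2 + c) where

  instance
    l-nonZero : ℕ.NonZero l
    l-nonZero = ℕ.>-nonZero (≤-trans (s≤s z≤n) l≥2)

  L a : ℕ
  L = 2 * l
  a = c + L

  isFilter⇔∣ : ∀ {x} → suc c ≤ x → isFilterℕ l j x ≡ true ⇔ l ∣ suc x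
  isFilter⇔∣ {x} c<x = mk⇔ to from
    where
    to : isFilterℕ l j x ≡ true → l ∣ suc x
    to filter = let i , _ , il≡ = isFilterℕ-sound l j filter in divides i (sym il≡)
    from : l ∣ suc x → isFilterℕ l j x ≡ true
    from (divides i ≡il) = isFilterℕ-complete l j i (≤-trans j≤k k≤i) (sym ≡il)
      where
      lk≤il : k * l ≤ i * l
      lk≤il = subst₂ _≤_ (trans (sym lk≡2+c) (*-comm l k)) ≡il (s≤s c<x)
      k≤i : k ≤ i
      k≤i = *-cancelʳ-≤ k i l lk≤il

  l∣L : l ∣ L
  l∣L = divides 2 refl

  ∣+L⇒∣ : ∀ {n} → l ∣ n + L → l ∣ n
  ∣+L⇒∣ {n} l∣n+L = ∣m+n∣m⇒∣n (subst (l ∣_) (+-comm n L) l∣n+L) l∣L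

  ∣⇒∣+L : ∀ {n} → l ∣ n → l ∣ n + L
  ∣⇒∣+L l∣n = ∣m∣n⇒∣m+n l∣n l∣L

  ∣suc⇒∤ : ∀ {n} → l ∣ suc n → ¬ l ∣ n
  ∣suc⇒∤ {n} l∣1+n l∣n = <⇒≢ l≥2 (sym (∣1⇒≡1 (∣m+n∣m⇒∣n (subst (l ∣_) (+-comm 1 n) l∣1+n) l∣n)))

  c<a : c < a
  c<a = m<m+n c (≤-trans (s≤s z≤n) (≤-trans l≥2 (m≤m+n l (l + 0))))

  l∣lk : l ∣ suc (suc c)
  l∣lk = subst (l ∣_) lk≡2+c (m∣m*n k)

  isFilter-landing : isFilterℕ l j (suc c) ≡ true
  isFilter-landing = Equivalence.from (isFilter⇔∣ ≤-refl) l∣lk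

  isFilter-beyond-takeoff : isFilterℕ l j (suc a) ≡ true
  isFilter-beyond-takeoff = Equivalence.from (isFilter⇔∣ (m≤m+n (suc c) L)) (∣⇒∣+L l∣lk)

  isFilter-takeoff : isFilterℕ l j a ≡ false
  isFilter-takeoff with isFilterℕ l j a in filter
  ... | false = refl
  ... | true  = ⊥-elim (∣suc⇒∤ l∣lk (∣+L⇒∣ (Equivalence.to (isFilter⇔∣ c<a) filter)))

  isFilter-periodic : ∀ {p} → suc c ≤ p → isFilterℕ l j (p + L) ≡ isFilterℕ l j p
  isFilter-periodic {p} c<p = ⇔→≡ (mk⇔
    (Equivalence.from (isFilter⇔∣ c<p) ∘ ∣+L⇒∣ ∘ Equivalence.to (isFilter⇔∣ c<p+L))
    (Equivalence.from (isFilter⇔∣ c<p+L) ∘ ∣⇒∣+L ∘ Equivalence.to (isFilter⇔∣ c<p)))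
    where
    c<p+L : suc c ≤ p + L
    c<p+L = ≤-trans c<p (m≤m+n p L)

  above-filter : ∀ {d p} → isFilterℕ l j d ≡ true → d ≤ suc p → isFilterℕ l j (suc p) ≡ false → d ≤ p
  above-filter filter d≤1+p nonFilter =
    s≤s⁻¹ (≤∧≢⇒< d≤1+p λ { refl → case trans (sym filter) nonFilter of λ () })

  weight : ℕ → ℕ
  weight p = if isFilterℕ l j p then 2 else 1

  stepsE : ℕ → List (ℤ × ℕ)
  stepsE zero    = (+ 1 , 1) ∷ []
  stepsE (suc p) = if isFilterℕ l j (suc p)
    then (+ suc (suc p) , 1) ∷ []
    else (+ suc (suc p) , 1) ∷ (+ p , weight p) ∷ []

  E W : Model
  E = elementary l j
  W = withLong l j k

  elementary-view : ∀ p y → E (+ p) y ≡ stepsE p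
  elementary-view zero    y = refl
  elementary-view (suc p) y rewrite +-comm p 1
    with isFilterℕ l j (suc p) | isFilterℕ l j p
  ... | true  | _     = refl
  ... | false | true  = refl
  ... | false | false = refl

  withLong-view : ∀ p y → W (+ p) y ≡ stepsE p ++ longSteps l k (+ p) y
  withLong-view p y = cong (_++ longSteps l k (+ p) y) (elementary-view p y)

  stepsE-All : ∀ (P : ℤ → Set) p → P (+ suc p) →
               (∀ {p′} → p ≡ suc p′ → isFilterℕ l j p ≡ false → P (+ p′)) →
               All (P ∘ proj₁) (stepsE p)
  stepsE-All P zero    right left = right ∷ []
  stepsE-All P (suc p) right left with isFilterℕ l j (suc p)
  ... | true  = right ∷ []
  ... | false = right ∷ left refl refl ∷ []

  stepSum-stepsE-nonFilter : ∀ f {p p′} → p ≡ suc p′ → isFilterℕ l j p ≡ false →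
                             stepSum f (stepsE p) ≡ f (+ suc p) + weight p′ * f (+ p′)
  stepSum-stepsE-nonFilter f {p′ = p′} refl nonFilter rewrite nonFilter =
    cong₂ _+_ (*-identityˡ (f (+ suc (suc p′)))) (+-identityʳ (weight p′ * f (+ p′)))

  stepsE-shift : ∀ {p} → suc c ≤ p → stepsE (p + L) ≡ map (map₁ (ℤ._+ + L)) (stepsE p)
  stepsE-shift {suc p} c<p rewrite isFilter-periodic c<p with isFilterℕ l j (suc p) in filter
  ... | true  = refl
  ... | false rewrite isFilter-periodic (above-filter isFilter-landing c<p filter) = refl

  landing≡ : + (l * k) ℤ.- ℤ.1ℤ ≡ + suc c
  landing≡ rewrite lk≡2+c = refl

  l*[k+2]≡2+a : l * (k + 2) ≡ 2 + a
  l*[k+2]≡2+a = trans (distrib l k) (cong (_+ L) lk≡2+c)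
    where
    distrib : ∀ l k → l * (k + 2) ≡ l * k + 2 * l
    distrib = solve-∀

  takeoff≡ : + (l * (k + 2)) ℤ.- + 2 ≡ + a
  takeoff≡ rewrite l*[k+2]≡2+a = refl

  longSteps-shape : ∀ p y → All (λ s → p ≡ a × proj₁ s ≡ + suc c) (longSteps l k (+ p) y)
  longSteps-shape p y with + p ℤ.≟ (+ (l * (k + 2)) ℤ.- + 2)
  ... | no _ = []
  ... | yes p≡ with ⌊ (+ (l * k) ℤ.- + 2) ℤ.≤? y ⌋ ∧ (ℤ.∣ y ℤ.- (+ (l * k) ℤ.- + 2) ∣ % 2 ≡ᵇ 0)
  ...   | false = []
  ...   | true  = (ℤ.+-injective (trans p≡ takeoff≡) , landing≡) ∷ []

  longSteps-takeoff : ∀ t → longSteps l k (+ a) (+ (c + 2 * t)) ≡ (+ suc c , 1) ∷ []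
  longSteps-takeoff t with + a ℤ.≟ (+ (l * (k + 2)) ℤ.- + 2)
  ... | no a≢ = ⊥-elim (a≢ (sym takeoff≡))
  ... | yes _ rewrite lk≡2+c
                    | +m≤?+[m+n] c (2 * t)
                    | ∣+[m+n]-+m∣≡n c (2 * t)
                    | 2*t%2≡0 t = refl

  withLong-off : ∀ {p} y → p ≢ a → W (+ p) y ≡ stepsE p
  withLong-off {p} y p≢a =
    trans (withLong-view p y) (trans (cong (stepsE p ++_) noSteps) (++-identityʳ (stepsE p)))
    where
    noSteps : longSteps l k (+ p) y ≡ []
    noSteps with longSteps l k (+ p) y | longSteps-shape p y
    ... | []    | _               = refl
    ... | _ ∷ _ | (p≡a , _) ∷ _ = ⊥-elim (p≢a p≡a)

  countFrom-E-suc : ∀ n p y M → countFrom E (suc n) (+ p) y M ≡ stepSum (countRest E n y M) (stepsE p)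
  countFrom-E-suc n p y M = trans (countFrom-suc E n (+ p) y M) (cong (stepSum _) (elementary-view p y))

  countFrom-E-unreachable : ∀ n p y m → n + p < m → countFrom E n (+ p) y (+ m) ≡ 0
  countFrom-E-unreachable zero    p y m p<m = countFrom-zero-≢ E y (<⇒≢ p<m ∘ ℤ.+-injective)
  countFrom-E-unreachable (suc n) p y m h   =
    trans (countFrom-E-suc n p y (+ m)) (stepSum-zero (stepsE-All _ p
      (countFrom-E-unreachable n (suc p) _ m (<-right-step h))
      λ { refl _ → countFrom-E-unreachable n _ _ m (<-left-step h) }))

  countFrom-beyond-filter : ∀ S {d m} → (∀ {p} y → d ≤ p → S (+ p) y ≡ stepsE p) →
    isFilterℕ l j d ≡ true → m < d → ∀ n {p} y → d ≤ p → countFrom S n (+ p) y (+ m) ≡ 0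
  countFrom-beyond-filter S S≡ filter m<d zero    y d≤p =
    countFrom-zero-≢ S y (λ p≡m → <⇒≢ (<-≤-trans m<d d≤p) (sym (ℤ.+-injective p≡m)))
  countFrom-beyond-filter S S≡ filter m<d (suc n) {p} y d≤p =
    trans (countFrom-suc S n (+ p) y _) (trans (cong (stepSum _) (S≡ y d≤p)) (stepSum-zero (stepsE-All _ p
      (beyond n _ (≤-trans d≤p (n≤1+n p)))
      λ { refl nonFilter → beyond n _ (above-filter filter d≤p nonFilter) })))
    where
    beyond = countFrom-beyond-filter S S≡ filter m<d

  countFrom-E-shift : ∀ n {p} y m → suc c ≤ p →
                      countFrom E n (+ (p + L)) y (+ (m + L)) ≡ countFrom E n (+ p) y (+ m)
  countFrom-E-shift zero {p} y m c<p = countFrom-zero-cong E E y y (mk⇔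
    (cong +_ ∘ +-cancelʳ-≡ L p m ∘ ℤ.+-injective)
    (cong (λ x → + (x + L)) ∘ ℤ.+-injective))
  countFrom-E-shift (suc n) {p} y m c<p = begin
    countFrom E (suc n) (+ (p + L)) y (+ (m + L))
      ≡⟨ countFrom-E-suc n (p + L) y _ ⟩
    stepSum (countRest E n y (+ (m + L))) (stepsE (p + L))
      ≡⟨ cong (stepSum _) (stepsE-shift c<p) ⟩
    stepSum (countRest E n y (+ (m + L))) (map (map₁ (ℤ._+ + L)) (stepsE p))
      ≡⟨ stepSum-map₁ _ _ (stepsE p) ⟩
    stepSum (countRest E n y (+ (m + L)) ∘ (ℤ._+ + L)) (stepsE p)
      ≡⟨ stepSum-cong (stepsE-All _ p
           (countFrom-E-shift n _ m (≤-trans c<p (n≤1+n p)))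
           λ { refl nonFilter →
                 countFrom-E-shift n _ m (above-filter isFilter-landing c<p nonFilter) }) ⟩
    stepSum (countRest E n y (+ m)) (stepsE p)
      ≡⟨ countFrom-E-suc n p y _ ⟨
    countFrom E (suc n) (+ p) y (+ m) ∎
    where open ≡-Reasoning

  withLong-takeoff : ∀ t → W (+ a) (+ (c + 2 * t)) ≡ stepsE a ++ (+ suc c , 1) ∷ []
  withLong-takeoff t = trans (withLong-view a _) (cong (stepsE a ++_) (longSteps-takeoff t))

  a≡1+pred[a] : a ≡ suc (pred a)
  a≡1+pred[a] = sym (suc-pred a {{ℕ.>-nonZero (≤-trans (s≤s z≤n) c<a)}})

  after-long-step : ∀ {n B} → suc n + a < L + B → n + suc c < B
  after-long-step {n} {B} = +-cancelˡ-< L (n + suc c) B ∘ subst (_< L + B) (regroup n c L)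
    where
    regroup : ∀ n c L → suc n + (c + L) ≡ L + (n + suc c)
    regroup = solve-∀

  -- A path from p to m using a long step needs at least (a − p) + 1 + (m − c − 1) = 2l + m − p steps.
  countFrom-W≡E : ∀ n p y m → n + p < L + m →
                  countFrom W n (+ p) y (+ m) ≡ countFrom E n (+ p) y (+ m)
  countFrom-W≡E zero    p y m _      = refl
  countFrom-W≡E (suc n) p y m budget = begin
    countFrom W (suc n) (+ p) y (+ m)
      ≡⟨ countFrom-suc W n (+ p) y _ ⟩
    stepSum fW (W (+ p) y)
      ≡⟨ cong (stepSum fW) (withLong-view p y) ⟩
    stepSum fW (stepsE p ++ longSteps l k (+ p) y)
      ≡⟨ stepSum-++ fW (stepsE p) _ ⟩
    stepSum fW (stepsE p) + stepSum fW (longSteps l k (+ p) y)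
      ≡⟨ cong₂ _+_ elementarySteps noLongSteps ⟩
    stepSum fE (stepsE p) + 0
      ≡⟨ +-identityʳ _ ⟩
    stepSum fE (stepsE p)
      ≡⟨ countFrom-E-suc n p y _ ⟨
    countFrom E (suc n) (+ p) y (+ m) ∎
    where
    open ≡-Reasoning
    fW fE : ℤ → ℕ
    fW = countRest W n y (+ m)
    fE = countRest E n y (+ m)
    elementarySteps : stepSum fW (stepsE p) ≡ stepSum fE (stepsE p)
    elementarySteps = stepSum-cong (stepsE-All _ p
      (countFrom-W≡E n (suc p) _ m (<-right-step budget))
      λ { refl _ → countFrom-W≡E n _ _ m (<-left-step budget) })
    noLongStep : ∀ {s : ℤ × ℕ} → p ≡ a × proj₁ s ≡ + suc c → fW (proj₁ s) ≡ 0
    noLongStep (p≡a , s≡) rewrite s≡ =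
      trans (countFrom-W≡E n (suc c) _ m (<-≤-trans unreachable (m≤n+m m L)))
            (countFrom-E-unreachable n (suc c) _ m unreachable)
      where
      unreachable : n + suc c < m
      unreachable = after-long-step (subst (λ p → suc n + p < L + m) p≡a budget)
    noLongSteps : stepSum fW (longSteps l k (+ p) y) ≡ 0
    noLongSteps = stepSum-zero (All.map (λ {s} → noLongStep {s}) (longSteps-shape p y))

  -- From (p, q) with q + 2l − p = 2t ≥ 0, every later visit to the abscissa a is at a height c + 2t′,
  -- where the long step is available.
  record Aligned (p q t : ℕ) : Set where
    constructor mkAligned
    field q+L≡p+2t : q + L ≡ p + 2 * t

  aligned-right : ∀ {p q t} → Aligned p q t → Aligned (suc p) (q + 1) t
  aligned-right {p} {q} {t} (mkAligned e) = mkAligned (trans (regroup q L) (cong suc e))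
    where
    regroup : ∀ q L → q + 1 + L ≡ suc (q + L)
    regroup = solve-∀

  aligned-left : ∀ {p q t} → Aligned (suc p) q t → Aligned p (q + 1) (suc t)
  aligned-left {p} {q} {t} (mkAligned e) =
    mkAligned (trans (regroup q L) (trans (cong suc e) (regroup′ p t)))
    where
    regroup : ∀ q L → q + 1 + L ≡ suc (q + L)
    regroup = solve-∀
    regroup′ : ∀ p t → suc (suc p + 2 * t) ≡ p + 2 * suc t
    regroup′ = solve-∀

  aligned-takeoff : ∀ {q t} → Aligned a q t → q ≡ c + 2 * t
  aligned-takeoff {q} {t} (mkAligned e) = +-cancelʳ-≡ L q (c + 2 * t) (trans e (regroup c L t))
    where
    regroup : ∀ c L t → c + L + 2 * t ≡ c + 2 * t + L
    regroup = solve-∀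

  Split : ℕ → ℕ → Set
  Split m n = ∀ {p q} t → p ≤ a → Aligned p q t → n + p < L + (L + m) →
    countFrom W n (+ p) (+ q) (+ m)
      ≡ countFrom E n (+ p) (+ q) (+ m) + countFrom E n (+ p) (+ q) (+ (m + L))

  split-zero : ∀ {m} → suc c ≤ m → Split m 0
  split-zero {m} c<m {p} {q} _ p≤a _ _ =
    sym (trans (cong (_+_ (countFrom E 0 (+ p) (+ q) (+ m))) (countFrom-zero-≢ E (+ q) p≢m+L))
               (+-identityʳ _))
    where
    p≢m+L : + p ≢ + (m + L)
    p≢m+L = <⇒≢ (≤-<-trans p≤a (+-monoˡ-< L c<m)) ∘ ℤ.+-injective

  split-left : ∀ {m n p p′ q t} → Split m n → p ≡ suc p′ → p ≤ a → Aligned p q t →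
    suc n + p < L + (L + m) →
    countRest W n (+ q) (+ m) (+ p′)
      ≡ countRest E n (+ q) (+ m) (+ p′) + countRest E n (+ q) (+ (m + L)) (+ p′)
  split-left {p′ = p′} {t = t} split refl p≤a aligned budget =
    split (suc t) (≤-trans (n≤1+n p′) p≤a) (aligned-left aligned) (<-left-step budget)

  split-below-takeoff : ∀ {m n p q t} → Split m n → p < a → Aligned p q t → suc n + p < L + (L + m) →
    countFrom W (suc n) (+ p) (+ q) (+ m)
      ≡ countFrom E (suc n) (+ p) (+ q) (+ m) + countFrom E (suc n) (+ p) (+ q) (+ (m + L))
  split-below-takeoff {m} {n} {p} {q} {t} split p<a aligned budget = begin
    countFrom W (suc n) (+ p) (+ q) (+ m)
      ≡⟨ countFrom-suc W n (+ p) (+ q) _ ⟩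
    stepSum fW (W (+ p) (+ q))
      ≡⟨ cong (stepSum fW) (withLong-off (+ q) (<⇒≢ p<a)) ⟩
    stepSum fW (stepsE p)
      ≡⟨ stepSum-cong (stepsE-All _ p
           (split t p<a (aligned-right aligned) (<-right-step budget))
           λ p≡ _ → split-left split p≡ (<⇒≤ p<a) aligned budget) ⟩
    stepSum (λ x → fE x + fE′ x) (stepsE p)
      ≡⟨ stepSum-+ fE fE′ (stepsE p) ⟩
    stepSum fE (stepsE p) + stepSum fE′ (stepsE p)
      ≡⟨ cong₂ _+_ (countFrom-E-suc n p (+ q) _) (countFrom-E-suc n p (+ q) _) ⟨
    countFrom E (suc n) (+ p) (+ q) (+ m) + countFrom E (suc n) (+ p) (+ q) (+ (m + L)) ∎
    where
    open ≡-Reasoning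
    fW fE fE′ : ℤ → ℕ
    fW  = countRest W n (+ q) (+ m)
    fE  = countRest E n (+ q) (+ m)
    fE′ = countRest E n (+ q) (+ (m + L))

  split-at-takeoff : ∀ {m n q t} → m ≤ a → Split m n → Aligned a q t → suc n + a < L + (L + m) →
    countFrom W (suc n) (+ a) (+ q) (+ m)
      ≡ countFrom E (suc n) (+ a) (+ q) (+ m) + countFrom E (suc n) (+ a) (+ q) (+ (m + L))
  split-at-takeoff {m} {n} {q} {t} m≤a split aligned budget = begin
    countFrom W (suc n) (+ a) (+ q) (+ m)
      ≡⟨ countFrom-suc W n (+ a) (+ q) _ ⟩
    stepSum fW (W (+ a) (+ q))
      ≡⟨ cong (stepSum fW) longStepAvailable ⟩
    stepSum fW (stepsE a ++ (+ suc c , 1) ∷ [])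
      ≡⟨ stepSum-++ fW (stepsE a) _ ⟩
    stepSum fW (stepsE a) + (1 * fW (+ suc c) + 0)
      ≡⟨ cong₂ _+_ (nonFilter fW) (trans (+-identityʳ _) (*-identityˡ _)) ⟩
    (fW (+ suc a) + w * fW (+ a′)) + fW (+ suc c)
      ≡⟨ cong₂ _+_ (cong₂ _+_ W-beyond (cong (w *_) leftStep)) longStep ⟩
    (0 + w * (fE (+ a′) + fE′ (+ a′))) + fE (+ suc c)
      ≡⟨ regroup w (fE (+ a′)) (fE′ (+ a′)) (fE (+ suc c)) ⟩
    (0 + w * fE (+ a′)) + (fE (+ suc c) + w * fE′ (+ a′))
      ≡⟨ cong₂ _+_ (cong (_+ w * fE (+ a′)) E-beyond) (cong (_+ w * fE′ (+ a′)) shift) ⟨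
    (fE (+ suc a) + w * fE (+ a′)) + (fE′ (+ suc a) + w * fE′ (+ a′))
      ≡⟨ cong₂ _+_ (trans (countFrom-E-suc n a (+ q) _) (nonFilter fE))
                   (trans (countFrom-E-suc n a (+ q) _) (nonFilter fE′)) ⟨
    countFrom E (suc n) (+ a) (+ q) (+ m) + countFrom E (suc n) (+ a) (+ q) (+ (m + L)) ∎
    where
    open ≡-Reasoning
    a′ w : ℕ
    a′ = pred a
    w  = weight a′
    fW fE fE′ : ℤ → ℕ
    fW  = countRest W n (+ q) (+ m)
    fE  = countRest E n (+ q) (+ m)
    fE′ = countRest E n (+ q) (+ (m + L))
    longStepAvailable : W (+ a) (+ q) ≡ stepsE a ++ (+ suc c , 1) ∷ []
    longStepAvailable = subst (λ q → W (+ a) (+ q) ≡ stepsE a ++ (+ suc c , 1) ∷ [])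
                              (sym (aligned-takeoff aligned)) (withLong-takeoff t)
    nonFilter : ∀ f → stepSum f (stepsE a) ≡ f (+ suc a) + w * f (+ a′)
    nonFilter f = stepSum-stepsE-nonFilter f a≡1+pred[a] isFilter-takeoff
    W-beyond : fW (+ suc a) ≡ 0
    W-beyond = countFrom-beyond-filter W (λ y a<p → withLong-off y (>⇒≢ a<p))
                 isFilter-beyond-takeoff (s≤s m≤a) n _ ≤-refl
    E-beyond : fE (+ suc a) ≡ 0
    E-beyond = countFrom-beyond-filter E (λ {p} y _ → elementary-view p y)
                 isFilter-beyond-takeoff (s≤s m≤a) n _ ≤-refl
    leftStep : fW (+ a′) ≡ fE (+ a′) + fE′ (+ a′)
    leftStep = split-left split a≡1+pred[a] ≤-refl aligned budget
    longStep : fW (+ suc c) ≡ fE (+ suc c)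
    longStep = countFrom-W≡E n (suc c) _ m (after-long-step budget)
    shift : fE′ (+ suc a) ≡ fE (+ suc c)
    shift = countFrom-E-shift n _ m ≤-refl
    regroup : ∀ w x y z → (0 + w * (x + y)) + z ≡ (0 + w * x) + (z + w * y)
    regroup = solve-∀

  split : ∀ {m} → suc c ≤ m → m ≤ a → ∀ n → Split m n
  split c<m m≤a zero = split-zero c<m
  split c<m m≤a (suc n) t p≤a aligned budget with m≤n⇒m<n∨m≡n p≤a
  ... | inj₁ p<a  = split-below-takeoff (split c<m m≤a n) p<a aligned budget
  ... | inj₂ refl = split-at-takeoff m≤a (split c<m m≤a n) aligned budget

  l*[k+4]≡2+c+4l : l * (k + 4) ≡ 2 + (c + (L + L))
  l*[k+4]≡2+c+4l = trans (distrib l k) (cong (_+ (L + L)) lk≡2+c)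
    where
    distrib : ∀ l k → l * (k + 4) ≡ l * k + (2 * l + 2 * l)
    distrib = solve-∀

  corollaryℕ : (M N : ℤ) → + suc c ℤ.≤ M → M ℤ.≤ + a → Corollary4p2-conclusion l j k M N
  corollaryℕ (+ m) -[1+ n ] _ _ = (λ _ → refl) , (λ _ _ → refl)
  corollaryℕ (+ m) (+ n) (ℤ.+≤+ c<m) (ℤ.+≤+ m≤a) =
      (λ n≤ → countFrom-W≡E n 0 (+ 0) m (short-budget n≤))
    , (λ _ n≤ → split c<m m≤a n l z≤n (mkAligned refl) (split-budget n≤))
    where
    short-budget : + n ℤ.≤ + (m + L) ℤ.- + 2 → n + 0 < L + m
    short-budget n≤ = begin-strict
      n + 0  ≡⟨ +-identityʳ n ⟩
      n      <⟨ n<1+n n ⟩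
      suc n  <⟨ n<1+n (suc n) ⟩
      2 + n  ≤⟨ ≤-minus-2 (m + L) n≤ ⟩
      m + L  ≡⟨ +-comm m L ⟩
      L + m  ∎
      where open ≤-Reasoning
    split-budget : + n ℤ.≤ + (l * (k + 4)) ℤ.- + 2 → n + 0 < L + (L + m)
    split-budget n≤ = begin-strict
      n + 0        ≡⟨ +-identityʳ n ⟩
      n            ≤⟨ s≤s⁻¹ (s≤s⁻¹ (subst (2 + n ≤_) l*[k+4]≡2+c+4l (≤-minus-2 (l * (k + 4)) n≤))) ⟩
      c + (L + L)  <⟨ +-monoˡ-< (L + L) c<m ⟩
      m + (L + L)  ≡⟨ +-comm m (L + L) ⟩
      (L + L) + m  ≡⟨ +-assoc L L m ⟩
      L + (L + m)  ∎
      where open ≤-Reasoning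

corollary4p2 : (l j k : ℕ) → 2 ≤ l → 1 ≤ j → j ≤ k →
    (M N : ℤ) → ℤ.∣ M ℤ.+ N ∣ ℕ.% 2 ≡ 0 →
    + (l ℕ.* k) ℤ.- + 1 ℤ.≤ M → M ℤ.≤ + (l ℕ.* (k ℕ.+ 2)) ℤ.- + 2 →
    (N ℤ.≤ M ℤ.+ + (2 ℕ.* l) ℤ.- + 2 → Z′ l j k M N ≡ Z l j M N)
    × (M ℤ.+ + (2 ℕ.* l) ℤ.≤ N → N ℤ.≤ + (l ℕ.* (k ℕ.+ 4)) ℤ.- + 2 →
       Z′ l j k M N ≡ Z l j M N ℕ.+ Z l j (M ℤ.+ + (2 ℕ.* l)) N)
corollary4p2 l j k l≥2 1≤j j≤k M N _ lk-1≤M M≤a =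
  corollaryℕ M N (subst (ℤ._≤ M) landing≡ lk-1≤M) (subst (M ℤ.≤_) takeoff≡ M≤a)
  where
  2≤lk : 2 ≤ l * k
  2≤lk = ≤-trans l≥2 (subst (_≤ l * k) (*-identityʳ l) (*-monoʳ-≤ l (≤-trans 1≤j j≤k)))
  c : ℕ
  c = proj₁ (m≤n⇒∃[o]m+o≡n 2≤lk)
  2+c≡lk : 2 + c ≡ l * k
  2+c≡lk = proj₂ (m≤n⇒∃[o]m+o≡n 2≤lk)
  open LongStepModel l j k c l≥2 j≤k (sym 2+c≡lk)
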